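{- For formulas $\phi,\psi$ of $\mathbf{PL}(\mathbin{\backslash\!\!\!/})$: if $\phi\models \psi$, then there is a $\theta$ such that $\phi\models \theta\models \psi$, and $\mathsf{P}^i(\theta)\subseteq \mathsf{P}^i(\phi)\cap \mathsf{P}^i(\psi)$ for any $i\in \{+,-\}$.
   Context: Classical formulas: $\alpha::=p\mid\bot\mid\neg\alpha\mid\alpha\wedge\alpha\mid\alpha\vee\alpha$; formulas of $\mathbf{PL}(\mathbin{\backslash\!\!\!/})$: $\phi::=\alpha\mid\phi\wedge\phi\mid\phi\vee\phi\mid\phi\mathbin{\backslash\!\!\!/}\phi$ ($\vee$ split disjunction, $\mathbin{\backslash\!\!\!/}$ inquisitive disjunction). Team semantics: a team is a set $t$ of valuations; $t\models p$ iff $v(p)=1$ for all $v\in t$; $t\models\bot$ iff $t=\emptyset$; $t\models\neg\alpha$ iff $\{v\}\not\models\alpha$ for all $v\in t$; $t\models\phi\wedge\psi$ iff both hold; $t\models\phi\vee\psi$ iff $t=s\cup u$ for some $s\models\phi$, $u\models\psi$; $t\models\phi\mathbin{\backslash\!\!\!/}\psi$ iff $t\models\phi$ or $t\models\psi$; $\phi\models\psi$ iff every team (with domain containing the relevant variables) satisfying $\phi$ satisfies $\psi$. An occurrence of a propositional variable is positive/negative in $\phi$ if it lies in the scope of an even/odd number of $\neg$; $\mathsf{P}^+(\phi)$/$\mathsf{P}^-(\phi)$ is the set of variables occurring positively/negatively in $\phi$. -}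

module Defs where

open import Data.Nat using (ℕ)
open import Data.Bool using (Bool; true; false)
open import Data.List using (List; []; _∷_; [_])
open import Data.List.Relation.Unary.All using (All)
open import Data.Product using (Σ; _×_; _,_)
open import Data.Sum using (_⊎_)
open import Data.Empty using (⊥)
open import Relation.Nullary using (¬_)
open import Relation.Binary.PropositionalEquality using (_≡_)

Var : Set
Var = ℕ

data CForm : Set where
  var  : Var → CForm
  bot  : CForm
  neg  : CForm → CForm
  cand : CForm → CForm → CForm
  cor  : CForm → CForm → CForm

data Form : Set where
  cl   : CForm → Form
  and  : Form → Form → Form
  or   : Form → Form → Form
  idis : Form → Form → Form

-- Valuations (total; a team over a domain X extends to total valuations,
-- and satisfaction only depends on the variables of the formula).
Val : Set
Val = Var → Bool

-- Teams: finite sets of valuations, represented as lists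
-- (semantics only depends on membership, so duplicates/order are irrelevant).
Team : Set
Team = List Val

-- Split t s u : t = s ∪ u with s, u ⊆ t (each member of t goes to s, u, or both).
data Split : Team → Team → Team → Set where
  nil   : Split [] [] []
  left  : ∀ {v t s u} → Split t s u → Split (v ∷ t) (v ∷ s) u
  right : ∀ {v t s u} → Split t s u → Split (v ∷ t) s (v ∷ u)
  both  : ∀ {v t s u} → Split t s u → Split (v ∷ t) (v ∷ s) (v ∷ u)

infix 4 _⊨c_ _⊨_
_⊨c_ : Team → CForm → Set
t ⊨c var p    = All (λ v → v p ≡ true) t
t ⊨c bot      = t ≡ []
t ⊨c neg α    = All (λ v → ¬ ([ v ] ⊨c α)) t
t ⊨c cand α β = (t ⊨c α) × (t ⊨c β)
t ⊨c cor α β  = Σ Team λ s → Σ Team λ u → Split t s u × (s ⊨c α) × (u ⊨c β)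

_⊨_ : Team → Form → Set
t ⊨ cl α       = t ⊨c α
t ⊨ and φ ψ    = (t ⊨ φ) × (t ⊨ ψ)
t ⊨ or φ ψ     = Σ Team λ s → Σ Team λ u → Split t s u × (s ⊨ φ) × (u ⊨ ψ)
t ⊨ idis φ ψ   = (t ⊨ φ) ⊎ (t ⊨ ψ)

infix 4 _⊫_
_⊫_ : Form → Form → Set
φ ⊫ ψ = ∀ (t : Team) → t ⊨ φ → t ⊨ ψ

data Pol : Set where
  + - : Pol

flip : Pol → Pol
flip + = -
flip - = +

data OccC : Pol → Var → CForm → Set where
  here  : ∀ {p} → OccC + p (var p)
  negO  : ∀ {i p α} → OccC (flip i) p α → OccC i p (neg α)
  candl : ∀ {i p α β} → OccC i p α → OccC i p (cand α β)
  candr : ∀ {i p α β} → OccC i p β → OccC i p (cand α β)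
  corl  : ∀ {i p α β} → OccC i p α → OccC i p (cor α β)
  corr  : ∀ {i p α β} → OccC i p β → OccC i p (cor α β)

data Occ : Pol → Var → Form → Set where
  clO   : ∀ {i p α} → OccC i p α → Occ i p (cl α)
  andl  : ∀ {i p φ ψ} → Occ i p φ → Occ i p (and φ ψ)
  andr  : ∀ {i p φ ψ} → Occ i p ψ → Occ i p (and φ ψ)
  orl   : ∀ {i p φ ψ} → Occ i p φ → Occ i p (or φ ψ)
  orr   : ∀ {i p φ ψ} → Occ i p ψ → Occ i p (or φ ψ)
  idisl : ∀ {i p φ ψ} → Occ i p φ → Occ i p (idis φ ψ)
  idisr : ∀ {i p φ ψ} → Occ i p ψ → Occ i p (idis φ ψ)

{-# OPTIONS --safe #-}

-- Every formula of PL(⩔) is equivalent to an inquisitive disjunction of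
-- classical formulas (NF), so it suffices to interpolate between a classical
-- α and ψ. Take γ to be the disjunction, over the consistent clauses C of a
-- DNF of α, of the conjunction of those literals of C that occur in ψ with
-- the same sign; clearly α ⊨ γ. Conversely, let t ⊨ γ and override each
-- v ∈ t by a clause C whose ψ-part holds at v. The new team satisfies α,
-- hence ψ; and as the ψ-literals of C already held at v, every literal of ψ
-- true after the override was true at v. Team satisfaction is monotone under
-- such pointwise changes, so t ⊨ ψ.

module Submission where

open import Defs
open import Data.Bool using (Bool; true; false)
import Data.Bool.Properties as Bool
open import Data.Nat using (_≟_)
open import Data.Empty using (⊥; ⊥-elim)
open import Data.Unit using (⊤; tt)
open import Data.Product as Product using (Σ; _×_; _,_; proj₁; ∃-syntax; ∃₂)
open import Data.Sum as Sum using (_⊎_; inj₁; inj₂; [_,_]′)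
open import Data.List using (List; []; _∷_; [_]; _++_; map; filter; cartesianProductWith)
open import Data.List.Relation.Unary.All as All using (All; []; _∷_)
import Data.List.Relation.Unary.All.Properties as All
open import Data.List.Relation.Unary.Any as Any using (Any; here; there)
import Data.List.Relation.Unary.Any.Properties as Any
open import Data.List.Relation.Binary.Pointwise as Pointwise using (Pointwise; []; _∷_)
open import Data.List.Membership.Propositional using (_∈_; find; lose)
open import Data.List.Membership.Propositional.Properties
  using (∈-++⁻; ∈-filter⁺; ∈-filter⁻; ∈-cartesianProductWith⁻)
open import Function using (_∘_)
open import Relation.Nullary using (¬_; Dec; yes; no)
open import Relation.Nullary.Decidable using (map′; _⊎-dec_)
open import Relation.Unary using (Decidable; _∪_)
open import Relation.Binary.PropositionalEquality using (_≡_; refl; sym; trans; subst)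

-- Polarised classical truth

toBool : Pol → Bool
toBool + = true
toBool - = false

toBool-injective : ∀ {i j} → toBool i ≡ toBool j → i ≡ j
toBool-injective { + } { + } _ = refl
toBool-injective { - } { - } _ = refl
toBool-injective { + } { - } ()
toBool-injective { - } { + } ()

toBool-flip-≢ : ∀ i → toBool i ≡ toBool (flip i) → ⊥
toBool-flip-≢ + ()
toBool-flip-≢ - ()

toBool-cover : ∀ b i → b ≡ toBool i ⊎ b ≡ toBool (flip i)
toBool-cover true  + = inj₁ refl
toBool-cover false + = inj₂ refl
toBool-cover true  - = inj₂ refl
toBool-cover false - = inj₁ refl

infixl 7 _·_
_·_ : Pol → Pol → Pol
+ · i = i
- · i = flip i

·-flipˡ : ∀ j i → flip j · i ≡ flip (j · i)
·-flipˡ + i = refl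
·-flipˡ - + = refl
·-flipˡ - - = refl

-- Truth (+) and falsity (-) at a valuation, defined simultaneously so that
-- negation only flips the polarity.
infix 4 _⊩⟨_⟩_
_⊩⟨_⟩_ : Val → Pol → CForm → Set
v ⊩⟨ i ⟩ var p    = v p ≡ toBool i
v ⊩⟨ + ⟩ bot      = ⊥
v ⊩⟨ - ⟩ bot      = ⊤
v ⊩⟨ i ⟩ neg α    = v ⊩⟨ flip i ⟩ α
v ⊩⟨ + ⟩ cand α β = v ⊩⟨ + ⟩ α × v ⊩⟨ + ⟩ β
v ⊩⟨ - ⟩ cand α β = v ⊩⟨ - ⟩ α ⊎ v ⊩⟨ - ⟩ β
v ⊩⟨ + ⟩ cor α β  = v ⊩⟨ + ⟩ α ⊎ v ⊩⟨ + ⟩ β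
v ⊩⟨ - ⟩ cor α β  = v ⊩⟨ - ⟩ α × v ⊩⟨ - ⟩ β

⊩-exclusive : ∀ {v} i α → v ⊩⟨ i ⟩ α → ¬ v ⊩⟨ flip i ⟩ α
⊩-exclusive i (var p)    x y = toBool-flip-≢ i (trans (sym x) y)
⊩-exclusive + bot        () _
⊩-exclusive - bot        _ ()
⊩-exclusive i (neg α)    x y = ⊩-exclusive (flip i) α x y
⊩-exclusive + (cand α β) (x , _) (inj₁ y) = ⊩-exclusive + α x y
⊩-exclusive + (cand α β) (_ , x) (inj₂ y) = ⊩-exclusive + β x y
⊩-exclusive - (cand α β) (inj₁ x) (y , _) = ⊩-exclusive - α x y
⊩-exclusive - (cand α β) (inj₂ x) (_ , y) = ⊩-exclusive - β x y
⊩-exclusive + (cor α β)  (inj₁ x) (y , _) = ⊩-exclusive + α x y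
⊩-exclusive + (cor α β)  (inj₂ x) (_ , y) = ⊩-exclusive + β x y
⊩-exclusive - (cor α β)  (x , _) (inj₁ y) = ⊩-exclusive - α x y
⊩-exclusive - (cor α β)  (_ , x) (inj₂ y) = ⊩-exclusive - β x y

both-or-either : ∀ {A A′ B B′ : Set} → A ⊎ A′ → B ⊎ B′ → (A × B) ⊎ (A′ ⊎ B′)
both-or-either (inj₁ a)  (inj₁ b)  = inj₁ (a , b)
both-or-either (inj₁ _)  (inj₂ b′) = inj₂ (inj₂ b′)
both-or-either (inj₂ a′) _         = inj₂ (inj₁ a′)

either-or-both : ∀ {A A′ B B′ : Set} → A ⊎ A′ → B ⊎ B′ → (A ⊎ B) ⊎ (A′ × B′)
either-or-both x y = Sum.swap (both-or-either (Sum.swap x) (Sum.swap y))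

⊩-total : ∀ v i α → v ⊩⟨ i ⟩ α ⊎ v ⊩⟨ flip i ⟩ α
⊩-total v i (var p)    = toBool-cover (v p) i
⊩-total v + bot        = inj₂ tt
⊩-total v - bot        = inj₁ tt
⊩-total v i (neg α)    = ⊩-total v (flip i) α
⊩-total v + (cand α β) = both-or-either (⊩-total v + α) (⊩-total v + β)
⊩-total v - (cand α β) = either-or-both (⊩-total v - α) (⊩-total v - β)
⊩-total v + (cor α β)  = either-or-both (⊩-total v + α) (⊩-total v + β)
⊩-total v - (cor α β)  = both-or-either (⊩-total v - α) (⊩-total v - β)

-- Flatness and monotonicity

All-∪⇒Split : ∀ {P Q : Val → Set} {t} → All (P ∪ Q) t →
              ∃₂ λ s u → Split t s u × All P s × All Q u
All-∪⇒Split [] = [] , [] , nil , [] , []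
All-∪⇒Split (inj₁ x ∷ a) =
  let s , u , sp , as , au = All-∪⇒Split a in _ ∷ s , u , left sp , x ∷ as , au
All-∪⇒Split (inj₂ y ∷ a) =
  let s , u , sp , as , au = All-∪⇒Split a in s , _ ∷ u , right sp , as , y ∷ au

Split⇒All-∪ : ∀ {P Q : Val → Set} {t s u} → Split t s u → All P s → All Q u →
              All (P ∪ Q) t
Split⇒All-∪ nil        []       []       = []
Split⇒All-∪ (left sp)  (x ∷ as) au       = inj₁ x ∷ Split⇒All-∪ sp as au
Split⇒All-∪ (right sp) as       (y ∷ au) = inj₂ y ∷ Split⇒All-∪ sp as au
Split⇒All-∪ (both sp)  (x ∷ as) (_ ∷ au) = inj₁ x ∷ Split⇒All-∪ sp as au

mutual
  ⊨c⇒⊩ : ∀ α {t} → t ⊨c α → All (_⊩⟨ + ⟩ α) t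
  ⊨c⇒⊩ (var p)    h       = h
  ⊨c⇒⊩ bot        refl    = []
  ⊨c⇒⊩ (neg α)    h       = All.map (¬⊨c⇒⊩⁻ α) h
  ⊨c⇒⊩ (cand α β) (x , y) = All.zip (⊨c⇒⊩ α x , ⊨c⇒⊩ β y)
  ⊨c⇒⊩ (cor α β)  (_ , _ , sp , x , y) = Split⇒All-∪ sp (⊨c⇒⊩ α x) (⊨c⇒⊩ β y)

  ⊩⇒⊨c : ∀ α {t} → All (_⊩⟨ + ⟩ α) t → t ⊨c α
  ⊩⇒⊨c (var p)    h        = h
  ⊩⇒⊨c bot        []       = refl
  ⊩⇒⊨c bot        (() ∷ _)
  ⊩⇒⊨c (neg α)    h        = All.map (λ x y → ⊩-exclusive - α x (All.head (⊨c⇒⊩ α y))) h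
  ⊩⇒⊨c (cand α β) h        = Product.map (⊩⇒⊨c α) (⊩⇒⊨c β) (All.unzip h)
  ⊩⇒⊨c (cor α β)  h        =
    let s , u , sp , x , y = All-∪⇒Split h in s , u , sp , ⊩⇒⊨c α x , ⊩⇒⊨c β y

  ¬⊨c⇒⊩⁻ : ∀ α {v} → ¬ [ v ] ⊨c α → v ⊩⟨ - ⟩ α
  ¬⊨c⇒⊩⁻ α {v} ¬v⊨α with ⊩-total v + α
  ... | inj₁ x = ⊥-elim (¬v⊨α (⊩⇒⊨c α (x ∷ [])))
  ... | inj₂ x = x

⊨-empty : ∀ φ → [] ⊨ φ
⊨-empty (cl α)     = ⊩⇒⊨c α []
⊨-empty (and φ ψ)  = ⊨-empty φ , ⊨-empty ψ
⊨-empty (or φ ψ)   = [] , [] , nil , ⊨-empty φ , ⊨-empty ψ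
⊨-empty (idis φ ψ) = inj₁ (⊨-empty φ)

Lit : Set
Lit = Pol × Var

infix 4 _⊨ₗ_ _⊨ₗ?_
_⊨ₗ_ : Val → Lit → Set
v ⊨ₗ (i , p) = v p ≡ toBool i

_⊨ₗ?_ : ∀ v → Decidable (v ⊨ₗ_)
v ⊨ₗ? (i , p) = v p Bool.≟ toBool i

_⊑⟨_⟩_ : Val → (Pol → Var → Set) → Val → Set
w ⊑⟨ L ⟩ v = ∀ i p → L i p → w ⊨ₗ (i , p) → v ⊨ₗ (i , p)

⊑-mono : ∀ {L L′ : Pol → Var → Set} {w v} → (∀ {i p} → L′ i p → L i p) →
         w ⊑⟨ L ⟩ v → w ⊑⟨ L′ ⟩ v
⊑-mono L′⊆L w⊑v i p o = w⊑v i p (L′⊆L o)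

⊩-mono : ∀ {w v} j α → w ⊑⟨ (λ i p → OccC (j · i) p α) ⟩ v →
         w ⊩⟨ j ⟩ α → v ⊩⟨ j ⟩ α
⊩-mono + (var q)    w⊑v x = w⊑v _ _ here x
⊩-mono - (var q)    w⊑v x = w⊑v _ _ here x
⊩-mono + bot        _   ()
⊩-mono - bot        _   _ = tt
⊩-mono j (neg α)    w⊑v x =
  ⊩-mono (flip j) α (λ i p o → w⊑v i p (negO (subst (λ k → OccC k p α) (·-flipˡ j i) o)))
         x
⊩-mono + (cand α β) w⊑v (x , y) =
  ⊩-mono + α (⊑-mono candl w⊑v) x , ⊩-mono + β (⊑-mono candr w⊑v) y
⊩-mono - (cand α β) w⊑v (inj₁ x) = inj₁ (⊩-mono - α (⊑-mono candl w⊑v) x)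
⊩-mono - (cand α β) w⊑v (inj₂ y) = inj₂ (⊩-mono - β (⊑-mono candr w⊑v) y)
⊩-mono + (cor α β)  w⊑v (inj₁ x) = inj₁ (⊩-mono + α (⊑-mono corl w⊑v) x)
⊩-mono + (cor α β)  w⊑v (inj₂ y) = inj₂ (⊩-mono + β (⊑-mono corr w⊑v) y)
⊩-mono - (cor α β)  w⊑v (x , y) =
  ⊩-mono - α (⊑-mono corl w⊑v) x , ⊩-mono - β (⊑-mono corr w⊑v) y

Pointwise-All : ∀ {A B : Set} {R : A → B → Set} {P : A → Set} {Q : B → Set} →
                (∀ {x y} → R x y → P x → Q y) →
                ∀ {xs ys} → Pointwise R xs ys → All P xs → All Q ys
Pointwise-All f []       []       = []
Pointwise-All f (r ∷ rs) (x ∷ px) = f r x ∷ Pointwise-All f rs px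

Split-Pointwise : ∀ {R : Val → Val → Set} {t′ t s′ u′} →
                  Pointwise R t′ t → Split t′ s′ u′ →
                  ∃₂ λ s u → Split t s u × Pointwise R s′ s × Pointwise R u′ u
Split-Pointwise []       nil        = [] , [] , nil , [] , []
Split-Pointwise (r ∷ rs) (left sp)  =
  let s , u , sp′ , rs₁ , rs₂ = Split-Pointwise rs sp
  in _ ∷ s , u , left sp′ , r ∷ rs₁ , rs₂
Split-Pointwise (r ∷ rs) (right sp) =
  let s , u , sp′ , rs₁ , rs₂ = Split-Pointwise rs sp
  in s , _ ∷ u , right sp′ , rs₁ , r ∷ rs₂
Split-Pointwise (r ∷ rs) (both sp)  =
  let s , u , sp′ , rs₁ , rs₂ = Split-Pointwise rs sp
  in _ ∷ s , _ ∷ u , both sp′ , r ∷ rs₁ , r ∷ rs₂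

⊨-mono : ∀ φ {t′ t} → Pointwise (_⊑⟨ (λ i p → Occ i p φ) ⟩_) t′ t → t′ ⊨ φ → t ⊨ φ
⊨-mono (cl α) rs h =
  ⊩⇒⊨c α (Pointwise-All (⊩-mono + α ∘ ⊑-mono clO) rs (⊨c⇒⊩ α h))
⊨-mono (and φ ψ) rs (x , y) =
  ⊨-mono φ (Pointwise.map (⊑-mono andl) rs) x ,
  ⊨-mono ψ (Pointwise.map (⊑-mono andr) rs) y
⊨-mono (or φ ψ) rs (_ , _ , sp , x , y) =
  let s , u , sp′ , rs₁ , rs₂ = Split-Pointwise rs sp
  in s , u , sp′ , ⊨-mono φ (Pointwise.map (⊑-mono orl) rs₁) x
                 , ⊨-mono ψ (Pointwise.map (⊑-mono orr) rs₂) y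
⊨-mono (idis φ ψ) rs (inj₁ x) = inj₁ (⊨-mono φ (Pointwise.map (⊑-mono idisl) rs) x)
⊨-mono (idis φ ψ) rs (inj₂ y) = inj₂ (⊨-mono ψ (Pointwise.map (⊑-mono idisr) rs) y)

-- Disjunctive normal forms

Clause : Set
Clause = List Lit

Sat : Val → Clause → Set
Sat v C = All (v ⊨ₗ_) C

infixr 6 _⊗_
_⊗_ : List Clause → List Clause → List Clause
_⊗_ = cartesianProductWith _++_

Sat-⊗⁺ : ∀ {v Cs Ds} → Any (Sat v) Cs → Any (Sat v) Ds → Any (Sat v) (Cs ⊗ Ds)
Sat-⊗⁺ = Any.cartesianProductWith⁺ _++_ All.++⁺

Sat-⊗⁻ : ∀ {v} Cs Ds → Any (Sat v) (Cs ⊗ Ds) → Any (Sat v) Cs × Any (Sat v) Ds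
Sat-⊗⁻ = Any.cartesianProductWith⁻ _++_ (λ {C} → All.++⁻ C)

∈-⊗⁻ : ∀ {l : Lit} Cs Ds → Any (l ∈_) (Cs ⊗ Ds) → Any (l ∈_) Cs ⊎ Any (l ∈_) Ds
∈-⊗⁻ Cs Ds l∈ with find l∈
... | _ , C∈ , l∈C with ∈-cartesianProductWith⁻ _++_ Cs Ds C∈
... | C₁ , _ , C₁∈ , C₂∈ , refl = Sum.map (lose C₁∈) (lose C₂∈) (∈-++⁻ C₁ l∈C)

dnf : Pol → CForm → List Clause
dnf i (var p)    = [ [ i , p ] ]
dnf + bot        = []
dnf - bot        = [ [] ]
dnf i (neg α)    = dnf (flip i) α
dnf + (cand α β) = dnf + α ⊗ dnf + β
dnf - (cand α β) = dnf - α ++ dnf - β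
dnf + (cor α β)  = dnf + α ++ dnf + β
dnf - (cor α β)  = dnf - α ⊗ dnf - β

dnf-sound : ∀ i α {v} → Any (Sat v) (dnf i α) → v ⊩⟨ i ⟩ α
dnf-sound i (var p)    (here (x ∷ [])) = x
dnf-sound i (var p)    (there ())
dnf-sound + bot        ()
dnf-sound - bot        _ = tt
dnf-sound i (neg α)    s = dnf-sound (flip i) α s
dnf-sound + (cand α β) s =
  Product.map (dnf-sound + α) (dnf-sound + β) (Sat-⊗⁻ (dnf + α) _ s)
dnf-sound - (cand α β) s = Sum.map (dnf-sound - α) (dnf-sound - β) (Any.++⁻ (dnf - α) s)
dnf-sound + (cor α β)  s = Sum.map (dnf-sound + α) (dnf-sound + β) (Any.++⁻ (dnf + α) s)
dnf-sound - (cor α β)  s =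
  Product.map (dnf-sound - α) (dnf-sound - β) (Sat-⊗⁻ (dnf - α) _ s)

dnf-complete : ∀ i α {v} → v ⊩⟨ i ⟩ α → Any (Sat v) (dnf i α)
dnf-complete i (var p)    x        = here (x ∷ [])
dnf-complete - bot        _        = here []
dnf-complete i (neg α)    x        = dnf-complete (flip i) α x
dnf-complete + (cand α β) (x , y)  = Sat-⊗⁺ (dnf-complete + α x) (dnf-complete + β y)
dnf-complete - (cand α β) (inj₁ x) = Any.++⁺ˡ (dnf-complete - α x)
dnf-complete - (cand α β) (inj₂ y) = Any.++⁺ʳ (dnf - α) (dnf-complete - β y)
dnf-complete + (cor α β)  (inj₁ x) = Any.++⁺ˡ (dnf-complete + α x)
dnf-complete + (cor α β)  (inj₂ y) = Any.++⁺ʳ (dnf + α) (dnf-complete + β y)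
dnf-complete - (cor α β)  (x , y)  = Sat-⊗⁺ (dnf-complete - α x) (dnf-complete - β y)

dnf-occ : ∀ j α {i p} → Any ((i , p) ∈_) (dnf j α) → OccC (j · i) p α
dnf-occ + (var q) (here (here refl)) = here
dnf-occ - (var q) (here (here refl)) = here
dnf-occ - bot     (here ())
dnf-occ j (neg α) {i} {p} l∈ =
  negO (subst (λ k → OccC k p α) (·-flipˡ j i) (dnf-occ (flip j) α l∈))
dnf-occ + (cand α β) l∈ with ∈-⊗⁻ (dnf + α) _ l∈
... | inj₁ l∈α = candl (dnf-occ + α l∈α)
... | inj₂ l∈β = candr (dnf-occ + β l∈β)
dnf-occ - (cand α β) l∈ with Any.++⁻ (dnf - α) l∈
... | inj₁ l∈α = candl (dnf-occ - α l∈α)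
... | inj₂ l∈β = candr (dnf-occ - β l∈β)
dnf-occ + (cor α β)  l∈ with Any.++⁻ (dnf + α) l∈
... | inj₁ l∈α = corl (dnf-occ + α l∈α)
... | inj₂ l∈β = corr (dnf-occ + β l∈β)
dnf-occ - (cor α β)  l∈ with ∈-⊗⁻ (dnf - α) _ l∈
... | inj₁ l∈α = corl (dnf-occ - α l∈α)
... | inj₂ l∈β = corr (dnf-occ - β l∈β)

override : Clause → Val → Val
override []            v p = v p
override ((i , q) ∷ C) v p with p ≟ q
... | yes _ = toBool i
... | no  _ = override C v p

override-Sat : ∀ {v C} → Sat v C → ∀ p → override C v p ≡ v p
override-Sat {C = []}          []      p = refl
override-Sat {C = (i , q) ∷ C} (x ∷ s) p with p ≟ q
... | yes refl = sym x
... | no  _    = override-Sat s p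

override-on-clause : ∀ C {i p v v′} → (i , p) ∈ C → override C v p ≡ override C v′ p
override-on-clause ((j , q) ∷ C) {p = p} l∈ with p ≟ q | l∈
... | yes _   | _          = refl
... | no  p≢q | here refl  = ⊥-elim (p≢q refl)
... | no  _   | there l∈C  = override-on-clause C l∈C

override-cases : ∀ C v p →
                 override C v p ≡ v p ⊎ ∃[ i ] (i , p) ∈ C × override C v p ≡ toBool i
override-cases []            v p = inj₁ refl
override-cases ((i , q) ∷ C) v p with p ≟ q
... | yes refl = inj₂ (i , here refl , refl)
... | no  _    = Sum.map₂ (λ (j , l∈ , e) → j , there l∈ , e) (override-cases C v p)

Sat-override-indep : ∀ C {v v′} → Sat (override C v) C → Sat (override C v′) C
Sat-override-indep C s =
  All.tabulate λ { {i , p} l∈ → trans (sym (override-on-clause C l∈)) (All.lookup s l∈) }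

-- A decidable form of satisfiability of C: by Sat-override-indep it does not
-- matter which valuation is overridden.
Consistent : Clause → Set
Consistent C = Sat (override C (λ _ → false)) C

consistent? : Decidable Consistent
consistent? C = All.all? (override C (λ _ → false) ⊨ₗ?_) C

Sat⇒Consistent : ∀ {v C} → Sat v C → Consistent C
Sat⇒Consistent {C = C} s =
  Sat-override-indep C (All.map (λ { {_ , p} x → trans (override-Sat s p) x }) s)

Consistent⇒Sat-override : ∀ {v C} → Consistent C → Sat (override C v) C
Consistent⇒Sat-override {C = C} = Sat-override-indep C

occC? : ∀ i p α → Dec (OccC i p α)
occC? + p (var q)    = map′ (λ { refl → here }) (λ { here → refl }) (p ≟ q)
occC? - p (var q)    = no λ ()
occC? i p bot        = no λ ()
occC? i p (neg α)    = map′ negO (λ { (negO o) → o }) (occC? (flip i) p α)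
occC? i p (cand α β) =
  map′ [ candl , candr ]′ (λ { (candl o) → inj₁ o ; (candr o) → inj₂ o })
       (occC? i p α ⊎-dec occC? i p β)
occC? i p (cor α β)  =
  map′ [ corl , corr ]′ (λ { (corl o) → inj₁ o ; (corr o) → inj₂ o })
       (occC? i p α ⊎-dec occC? i p β)

occ? : ∀ i p φ → Dec (Occ i p φ)
occ? i p (cl α)     = map′ clO (λ { (clO o) → o }) (occC? i p α)
occ? i p (and φ ψ)  =
  map′ [ andl , andr ]′ (λ { (andl o) → inj₁ o ; (andr o) → inj₂ o })
       (occ? i p φ ⊎-dec occ? i p ψ)
occ? i p (or φ ψ)   =
  map′ [ orl , orr ]′ (λ { (orl o) → inj₁ o ; (orr o) → inj₂ o })
       (occ? i p φ ⊎-dec occ? i p ψ)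
occ? i p (idis φ ψ) =
  map′ [ idisl , idisr ]′ (λ { (idisl o) → inj₁ o ; (idisr o) → inj₂ o })
       (occ? i p φ ⊎-dec occ? i p ψ)

_occursIn_ : Lit → Form → Set
(i , p) occursIn φ = Occ i p φ

_occursIn?_ : ∀ l φ → Dec (l occursIn φ)
(i , p) occursIn? φ = occ? i p φ

restrict : Form → Clause → Clause
restrict ψ = filter (_occursIn? ψ)

override-⊑ : ∀ ψ C {v} → Sat v (restrict ψ C) → override C v ⊑⟨ (λ i p → Occ i p ψ) ⟩ v
override-⊑ ψ C {v} s i p o e with override-cases C v p
... | inj₁ unchanged = trans (sym unchanged) e
... | inj₂ (j , l∈C , e′) with toBool-injective (trans (sym e′) e)
... | refl = All.lookup s (∈-filter⁺ (_occursIn? ψ) l∈C o)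

-- Interpolants for classical antecedents

literal : Lit → CForm
literal (+ , p) = var p
literal (- , p) = neg (var p)

conj : Clause → CForm
conj []      = neg bot
conj (l ∷ C) = cand (literal l) (conj C)

conj-intro : ∀ {v C} → Sat v C → v ⊩⟨ + ⟩ conj C
conj-intro                   []      = tt
conj-intro {C = (+ , _) ∷ _} (x ∷ s) = x , conj-intro s
conj-intro {C = (- , _) ∷ _} (x ∷ s) = x , conj-intro s

conj-elim : ∀ {v} C → v ⊩⟨ + ⟩ conj C → Sat v C
conj-elim []            _       = []
conj-elim ((+ , _) ∷ C) (x , y) = x ∷ conj-elim C y
conj-elim ((- , _) ∷ C) (x , y) = x ∷ conj-elim C y

conj-occ : ∀ C {i p} → OccC i p (conj C) → (i , p) ∈ C
conj-occ []            (negO ())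
conj-occ ((+ , q) ∷ C) (candl here) = here refl
conj-occ ((- , q) ∷ C) {+} (candl (negO ()))
conj-occ ((- , q) ∷ C) { - } (candl (negO here)) = here refl
conj-occ (_ ∷ C)       (candr o) = there (conj-occ C o)

⋁ : List CForm → CForm
⋁ []       = bot
⋁ (α ∷ αs) = cor α (⋁ αs)

⋁-intro : ∀ {v αs} → Any (v ⊩⟨ + ⟩_) αs → v ⊩⟨ + ⟩ ⋁ αs
⋁-intro (here x)  = inj₁ x
⋁-intro (there x) = inj₂ (⋁-intro x)

⋁-elim : ∀ {v} αs → v ⊩⟨ + ⟩ ⋁ αs → Any (v ⊩⟨ + ⟩_) αs
⋁-elim (α ∷ αs) (inj₁ x) = here x
⋁-elim (α ∷ αs) (inj₂ x) = there (⋁-elim αs x)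

⋁-occ : ∀ αs {i p} → OccC i p (⋁ αs) → Any (OccC i p) αs
⋁-occ (α ∷ αs) (corl o) = here o
⋁-occ (α ∷ αs) (corr o) = there (⋁-occ αs o)

-- Inconsistent clauses must be dropped: their restriction to ψ may well be
-- satisfiable.
interpolantClauses : Form → CForm → List CForm
interpolantClauses ψ α = map (conj ∘ restrict ψ) (filter consistent? (dnf + α))

interpolantᶜ : Form → CForm → CForm
interpolantᶜ ψ α = ⋁ (interpolantClauses ψ α)

⊩-interpolantᶜ : ∀ ψ α {v} → v ⊩⟨ + ⟩ α → v ⊩⟨ + ⟩ interpolantᶜ ψ α
⊩-interpolantᶜ ψ α x with find (dnf-complete + α x)
... | C , C∈dnf , s = ⋁-intro (Any.map⁺ (lose
  (∈-filter⁺ consistent? C∈dnf (Sat⇒Consistent s))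
  (conj-intro (All.filter⁺ (_occursIn? ψ) s))))

interpolantᶜ-witness : ∀ ψ α {v} → v ⊩⟨ + ⟩ interpolantᶜ ψ α →
                       ∃[ w ] w ⊩⟨ + ⟩ α × w ⊑⟨ (λ i p → Occ i p ψ) ⟩ v
interpolantᶜ-witness ψ α {v} x with find (Any.map⁻ (⋁-elim (interpolantClauses ψ α) x))
... | C , C∈ , s with ∈-filter⁻ consistent? C∈
... | C∈dnf , C-consistent =
  override C v ,
  dnf-sound + α (lose C∈dnf (Consistent⇒Sat-override C-consistent)) ,
  override-⊑ ψ C (conj-elim (restrict ψ C) s)

interpolantᶜ-occ : ∀ ψ α {i p} → OccC i p (interpolantᶜ ψ α) → OccC i p α × Occ i p ψ
interpolantᶜ-occ ψ α o with find (Any.map⁻ (⋁-occ (interpolantClauses ψ α) o))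
... | C , C∈ , o′ with ∈-filter⁻ (_occursIn? ψ) (conj-occ (restrict ψ C) o′)
... | l∈C , oψ = dnf-occ + α (lose (proj₁ (∈-filter⁻ consistent? C∈)) l∈C) , oψ

⊫-interpolantᶜ : ∀ ψ α → cl α ⊫ cl (interpolantᶜ ψ α)
⊫-interpolantᶜ ψ α t h = ⊩⇒⊨c (interpolantᶜ ψ α) (All.map (⊩-interpolantᶜ ψ α) (⊨c⇒⊩ α h))

All-∃⇒Pointwise : ∀ {A B : Set} {P : A → Set} {R : A → B → Set} {ys} →
                  All (λ y → ∃[ x ] P x × R x y) ys → ∃[ xs ] All P xs × Pointwise R xs ys
All-∃⇒Pointwise []                = [] , [] , []
All-∃⇒Pointwise ((x , px , r) ∷ a) =
  let xs , pxs , rs = All-∃⇒Pointwise a in x ∷ xs , px ∷ pxs , r ∷ rs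

interpolantᶜ-⊫ : ∀ ψ α → cl α ⊫ ψ → cl (interpolantᶜ ψ α) ⊫ ψ
interpolantᶜ-⊫ ψ α α⊫ψ t h =
  let t′ , t′⊩α , t′⊑t =
        All-∃⇒Pointwise (All.map (interpolantᶜ-witness ψ α) (⊨c⇒⊩ (interpolantᶜ ψ α) h))
  in ⊨-mono ψ t′⊑t (α⊫ψ t′ (⊩⇒⊨c α t′⊩α))

-- Normal forms of PL(⩔) formulas

NF : Form → List CForm
NF (cl α)     = [ α ]
NF (and φ ψ)  = cartesianProductWith cand (NF φ) (NF ψ)
NF (or φ ψ)   = cartesianProductWith cor (NF φ) (NF ψ)
NF (idis φ ψ) = NF φ ++ NF ψ

NF-complete : ∀ φ {t} → t ⊨ φ → Any (t ⊨c_) (NF φ)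
NF-complete (cl α)     h        = here h
NF-complete (and φ ψ)  (x , y)  =
  Any.cartesianProductWith⁺ cand _,_ (NF-complete φ x) (NF-complete ψ y)
NF-complete (or φ ψ)   (s , u , sp , x , y) =
  Any.cartesianProductWith⁺ cor (λ x′ y′ → s , u , sp , x′ , y′)
                            (NF-complete φ x) (NF-complete ψ y)
NF-complete (idis φ ψ) (inj₁ x) = Any.++⁺ˡ (NF-complete φ x)
NF-complete (idis φ ψ) (inj₂ y) = Any.++⁺ʳ (NF φ) (NF-complete ψ y)

NF-sound : ∀ φ {α t} → α ∈ NF φ → t ⊨c α → t ⊨ φ
NF-sound (cl α)     (here refl) h = h
NF-sound (and φ ψ)  α∈ h with ∈-cartesianProductWith⁻ cand (NF φ) (NF ψ) α∈
... | _ , _ , α∈φ , β∈ψ , refl = Product.map (NF-sound φ α∈φ) (NF-sound ψ β∈ψ) h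
NF-sound (or φ ψ)   α∈ h with ∈-cartesianProductWith⁻ cor (NF φ) (NF ψ) α∈
... | _ , _ , α∈φ , β∈ψ , refl =
  let s , u , sp , x , y = h in s , u , sp , NF-sound φ α∈φ x , NF-sound ψ β∈ψ y
NF-sound (idis φ ψ) α∈ h with ∈-++⁻ (NF φ) α∈
... | inj₁ α∈φ = inj₁ (NF-sound φ α∈φ h)
... | inj₂ α∈ψ = inj₂ (NF-sound ψ α∈ψ h)

NF-occ : ∀ φ {α i p} → α ∈ NF φ → OccC i p α → Occ i p φ
NF-occ (cl α)     (here refl) o = clO o
NF-occ (and φ ψ)  α∈ o with ∈-cartesianProductWith⁻ cand (NF φ) (NF ψ) α∈ | o
... | _ , _ , α∈φ , _   , refl | candl o′ = andl (NF-occ φ α∈φ o′)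
... | _ , _ , _   , β∈ψ , refl | candr o′ = andr (NF-occ ψ β∈ψ o′)
NF-occ (or φ ψ)   α∈ o with ∈-cartesianProductWith⁻ cor (NF φ) (NF ψ) α∈ | o
... | _ , _ , α∈φ , _   , refl | corl o′ = orl (NF-occ φ α∈φ o′)
... | _ , _ , _   , β∈ψ , refl | corr o′ = orr (NF-occ ψ β∈ψ o′)
NF-occ (idis φ ψ) α∈ o with ∈-++⁻ (NF φ) α∈
... | inj₁ α∈φ = idisl (NF-occ φ α∈φ o)
... | inj₂ α∈ψ = idisr (NF-occ ψ α∈ψ o)

⩔ : List Form → Form
⩔ []       = cl bot
⩔ (χ ∷ χs) = idis χ (⩔ χs)

⩔-intro : ∀ {t χs} → Any (t ⊨_) χs → t ⊨ ⩔ χs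
⩔-intro (here x)  = inj₁ x
⩔-intro (there x) = inj₂ (⩔-intro x)

⩔-least : ∀ ψ {χs} → All (_⊫ ψ) χs → ⩔ χs ⊫ ψ
⩔-least ψ []         _ refl     = ⊨-empty ψ
⩔-least ψ (χ⊫ψ ∷ _)  t (inj₁ x) = χ⊫ψ t x
⩔-least ψ (_ ∷ χs⊫ψ) t (inj₂ x) = ⩔-least ψ χs⊫ψ t x

⩔-occ : ∀ χs {i p} → Occ i p (⩔ χs) → Any (Occ i p) χs
⩔-occ []       (clO ())
⩔-occ (χ ∷ χs) (idisl o) = here o
⩔-occ (χ ∷ χs) (idisr o) = there (⩔-occ χs o)

mainTheorem12 : (φ ψ : Form) → φ ⊫ ψ →
    Σ Form λ θ → (φ ⊫ θ) × (θ ⊫ ψ) ×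
      (∀ (i : Pol) (p : Var) → Occ i p θ → Occ i p φ × Occ i p ψ)
mainTheorem12 φ ψ φ⊫ψ = ⩔ θs , φ⊫θ , θ⊫ψ , θ-occ
  where
  θs : List Form
  θs = map (cl ∘ interpolantᶜ ψ) (NF φ)

  φ⊫θ : φ ⊫ ⩔ θs
  φ⊫θ t h = ⩔-intro (Any.map⁺ (Any.map (⊫-interpolantᶜ ψ _ t) (NF-complete φ h)))

  θ⊫ψ : ⩔ θs ⊫ ψ
  θ⊫ψ = ⩔-least ψ (All.map⁺ (All.tabulate λ α∈ →
          interpolantᶜ-⊫ ψ _ λ t → φ⊫ψ t ∘ NF-sound φ α∈))

  θ-occ : ∀ i p → Occ i p (⩔ θs) → Occ i p φ × Occ i p ψ
  θ-occ i p o with find (Any.map⁻ (⩔-occ θs o))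
  ... | α , α∈ , clO o′ = Product.map₁ (NF-occ φ α∈) (interpolantᶜ-occ ψ α o′)
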